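{- Left and right contraction are height-preserving admissible in the sequent calculus $\mathsf{GWF}$: for all finite multisets $\Gamma,\Delta$, every formula $D$ and every $n\ge0$, if $D,D,\Gamma\Rightarrow\Delta$ has a derivation in $\mathsf{GWF}$ of height at most $n$ then so does $D,\Gamma\Rightarrow\Delta$, and if $\Gamma\Rightarrow\Delta,D,D$ has a derivation in $\mathsf{GWF}$ of height at most $n$ then so does $\Gamma\Rightarrow\Delta,D$.
   Context: Formulas are built from a countable set of propositional atoms $p,q,\dots$ and the constant $\bot$ using the binary connectives $\wedge,\vee,\rightarrow$. A sequent $\Gamma\Rightarrow\Delta$ consists of two finite, possibly empty, multisets $\Gamma,\Delta$ of formulas; commas denote multiset union. The calculus $\mathsf{GWF}$ has the following rules ($p$ atomic, $\Gamma,\Delta$ arbitrary multisets): (Ax) $p,\Gamma\Rightarrow\Delta,p$ with no premises; ($\bot_L$) $\bot,\Gamma\Rightarrow\Delta$ with no premises; ($\wedge_L$) from $A,B,\Gamma\Rightarrow\Delta$ infer $A\wedge B,\Gamma\Rightarrow\Delta$; ($\wedge_R$) from $\Gamma\Rightarrow\Delta,A$ and $\Gamma\Rightarrow\Delta,B$ infer $\Gamma\Rightarrow\Delta,A\wedge B$; ($\vee_L$) from $A,\Gamma\Rightarrow\Delta$ and $B,\Gamma\Rightarrow\Delta$ infer $A\vee B,\Gamma\Rightarrow\Delta$; ($\vee_R$) from $\Gamma\Rightarrow\Delta,A,B$ infer $\Gamma\Rightarrow\Delta,A\vee B$; ($\rightarrow_R$) from $A\Rightarrow B$ infer $\Gamma\Rightarrow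 A\rightarrow B,\Delta$; ($\rightarrow_{LR}$) from $A\Rightarrow B$, $B\Rightarrow A$, $C\Rightarrow D$, $D\Rightarrow C$ infer $\Gamma,A\rightarrow C\Rightarrow B\rightarrow D,\Delta$. A derivation is either an instance of Ax or $\bot_L$, or an application of a rule to derivations of its premises. The height of a derivation is the greatest number of successive rule applications in it, where instances of Ax and $\bot_L$ have height $0$. -}

module Defs where

open import Data.Nat using (ℕ; zero; suc; _≤_; _⊔_)
open import Data.List using (List; []; _∷_; _++_)
open import Data.Product using (Σ; ∃; _×_; _,_)
open import Data.List.Relation.Binary.Permutation.Propositional using (_↭_)

data Fm : Set where
  at   : ℕ → Fm
  ⊥′   : Fm
  _∧′_ : Fm → Fm → Fm
  _∨′_ : Fm → Fm → Fm
  _⇒′_ : Fm → Fm → Fm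

-- Finite multisets are represented by lists, considered up to
-- permutation (_↭_).  A derivation of a sequent Γ ⇒ Δ is a derivation
-- tree whose conclusion has lists Γ' ↭ Γ and Δ' ↭ Δ.
-- In the raw derivation type, the principal formula is placed at the
-- head of the antecedent (left) / head of the succedent (right); the
-- order is immaterial since sequents are compared up to ↭.
data Der : List Fm → List Fm → Set where
  ax   : ∀ p Γ Δ → Der (at p ∷ Γ) (at p ∷ Δ)
  ⊥L   : ∀ Γ Δ → Der (⊥′ ∷ Γ) Δ
  ∧L   : ∀ {A B Γ Δ} → Der (A ∷ B ∷ Γ) Δ → Der (A ∧′ B ∷ Γ) Δ
  ∧R   : ∀ {A B Γ Δ} → Der Γ (A ∷ Δ) → Der Γ (B ∷ Δ) → Der Γ (A ∧′ B ∷ Δ)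
  ∨L   : ∀ {A B Γ Δ} → Der (A ∷ Γ) Δ → Der (B ∷ Γ) Δ → Der (A ∨′ B ∷ Γ) Δ
  ∨R   : ∀ {A B Γ Δ} → Der Γ (A ∷ B ∷ Δ) → Der Γ (A ∨′ B ∷ Δ)
  ⇒R   : ∀ {A B} Γ Δ → Der (A ∷ []) (B ∷ []) → Der Γ (A ⇒′ B ∷ Δ)
  ⇒LR  : ∀ {A B C D} Γ Δ →
         Der (A ∷ []) (B ∷ []) → Der (B ∷ []) (A ∷ []) →
         Der (C ∷ []) (D ∷ []) → Der (D ∷ []) (C ∷ []) →
         Der (A ⇒′ C ∷ Γ) (B ⇒′ D ∷ Δ)
  -- Multiset reading: a derivation may be read as concluding any
  -- permutation-equivalent sequent; this does not count as a rule
  -- application (height unchanged).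
  perm : ∀ {Γ Γ' Δ Δ'} → Γ ↭ Γ' → Δ ↭ Δ' → Der Γ Δ → Der Γ' Δ'

height : ∀ {Γ Δ} → Der Γ Δ → ℕ
height (ax _ _ _) = 0
height (⊥L _ _) = 0
height (∧L d) = suc (height d)
height (∧R d e) = suc (height d ⊔ height e)
height (∨L d e) = suc (height d ⊔ height e)
height (∨R d) = suc (height d)
height (⇒R _ _ d) = suc (height d)
height (⇒LR _ _ d₁ d₂ d₃ d₄) = suc (height d₁ ⊔ height d₂ ⊔ height d₃ ⊔ height d₄)
height (perm _ _ d) = height d

Derivable≤ : ℕ → List Fm → List Fm → Set
Derivable≤ n Γ Δ = Σ (Der Γ Δ) λ d → height d ≤ n

-- Axioms and
-- the rules →R and →LR admit arbitrary side formulas, so they absorb any change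
-- of context.  If no copy of D is principal in the last rule, contraction is
-- pushed into the premises.  If one is, D is a conjunction or disjunction; the
-- height-preserving invertibility of the ∧/∨ rules, proved by the same
-- induction, replaces the other copy of D in the premises by its immediate
-- subformulas, which now occur twice and are contracted at the smaller height
-- before the rule is reapplied.

module Submission where

open import Defs
open import Data.Nat using (ℕ; suc; _≤_; z≤n; s≤s)
open import Data.Nat.Properties using (≤-trans; n≤1+n; ⊔-lub; m⊔n≤o⇒m≤o; m⊔n≤o⇒n≤o)
open import Data.List using (List; []; _∷_; _++_; _∷ʳ_)
open import Data.List.Membership.Propositional using (_∈_)
open import Data.List.Membership.Propositional.Properties using (∈-∃++; ∈-++⁺ˡ; ∈-++⁻)
open import Data.List.Relation.Unary.Any using (here; there)
open import Data.List.Relation.Binary.Subset.Propositional using (_⊆_)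
import Data.List.Relation.Binary.Subset.Propositional.Properties as ⊆
open import Data.List.Relation.Binary.Permutation.Propositional
  using (_↭_; prep; ↭-refl; ↭-sym; ↭-trans)
open import Data.List.Relation.Binary.Permutation.Propositional.Properties
  using (∈-resp-↭; drop-∷; shift; ++⁺ˡ; ++⁺ʳ; ++-comm; ∷↭∷ʳ)
open import Data.Product using (_×_; _,_; ∃)
open import Data.Sum using (_⊎_; inj₁; inj₂)
open import Function using (case_of_)
open import Relation.Binary.PropositionalEquality using (_≡_; refl)

private
  variable
    S : Set
    x y : S
    xs ys : List S
    n p : ℕ
    A B D F : Fm
    Γ Δ L X Y : List Fm

∷↭⇒∈ : x ∷ xs ↭ ys → x ∈ ys
∷↭⇒∈ x∷xs↭ys = ∈-resp-↭ x∷xs↭ys (here refl)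

∈⇒↭∷ : x ∈ xs → ∃ λ ys → xs ↭ x ∷ ys
∈⇒↭∷ x∈xs with ys , zs , refl ← ∈-∃++ x∈xs = ys ++ zs , shift _ ys zs

∈-∷ʳ⁻ : ∀ xs → x ∈ xs ∷ʳ y → x ∈ xs ⊎ x ≡ y
∈-∷ʳ⁻ xs x∈ with ∈-++⁻ xs x∈
... | inj₁ x∈xs = inj₁ x∈xs
... | inj₂ (here x≡y) = inj₂ x≡y

dup-⊆ : ∀ xs → xs ++ y ∷ y ∷ [] ⊆ xs ∷ʳ y
dup-⊆ xs = ⊆.++⁺ʳ xs λ { (here e) → here e ; (there y∈) → y∈ }

∷↭++-inv : ∀ ys zs → x ∷ xs ↭ ys ++ zs →
  x ∈ zs ⊎ ∃ λ ys′ → ys ↭ x ∷ ys′ × xs ↭ ys′ ++ zs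
∷↭++-inv ys zs p with ∈-++⁻ ys (∷↭⇒∈ p)
... | inj₂ x∈zs = inj₁ x∈zs
... | inj₁ x∈ys with ys′ , q ← ∈⇒↭∷ x∈ys =
  inj₂ (ys′ , q , drop-∷ (↭-trans p (++⁺ʳ zs q)))

∷↭∷ʳ-inv : ∀ ys → x ∷ xs ↭ ys ∷ʳ y →
  (x ≡ y × xs ↭ ys) ⊎ ∃ λ ys′ → ys ↭ x ∷ ys′ × xs ↭ ys′ ∷ʳ y
∷↭∷ʳ-inv ys p with ∷↭++-inv ys _ p
... | inj₁ (here refl) = inj₁ (refl , drop-∷ (↭-trans p (↭-sym (∷↭∷ʳ _ ys))))
... | inj₂ q = inj₂ q

∷↭++∷∷-inv : ∀ ys → x ∷ xs ↭ ys ++ y ∷ y ∷ [] →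
  (x ≡ y × xs ↭ ys ∷ʳ y) ⊎ ∃ λ ys′ → ys ↭ x ∷ ys′ × xs ↭ ys′ ++ y ∷ y ∷ []
∷↭++∷∷-inv ys p with ∷↭++-inv ys _ p
... | inj₁ (here refl) = inj₁ (refl , drop-∷ (↭-trans p (shift _ ys _)))
... | inj₁ (there (here refl)) = inj₁ (refl , drop-∷ (↭-trans p (shift _ ys _)))
... | inj₂ q = inj₂ q

↭-++-comm : ∀ zs → xs ↭ ys → zs ++ xs ↭ ys ++ zs
↭-++-comm {ys = ys} zs xs↭ys = ↭-trans (++⁺ˡ zs xs↭ys) (++-comm zs ys)

Derivable≤-mono : ∀ {m} → m ≤ n → Derivable≤ m X Y → Derivable≤ n X Y
Derivable≤-mono m≤n (d , h) = d , ≤-trans h m≤n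

Derivable≤-respˡ-↭ : ∀ {X′} → X ↭ X′ → Derivable≤ n X Y → Derivable≤ n X′ Y
Derivable≤-respˡ-↭ X↭X′ (d , h) = perm X↭X′ ↭-refl d , h

Derivable≤-respʳ-↭ : ∀ {Y′} → Y ↭ Y′ → Derivable≤ n X Y → Derivable≤ n X Y′
Derivable≤-respʳ-↭ Y↭Y′ (d , h) = perm ↭-refl Y↭Y′ d , h

Derivable≤-from-∈ˡ : A ∈ X → (∀ Γ → Derivable≤ n (A ∷ Γ) Y) → Derivable≤ n X Y
Derivable≤-from-∈ˡ A∈X der with Γ , X↭ ← ∈⇒↭∷ A∈X = Derivable≤-respˡ-↭ (↭-sym X↭) (der Γ)

Derivable≤-from-∈ʳ : A ∈ Y → (∀ Δ → Derivable≤ n X (A ∷ Δ)) → Derivable≤ n X Y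
Derivable≤-from-∈ʳ A∈Y der with Δ , Y↭ ← ∈⇒↭∷ A∈Y = Derivable≤-respʳ-↭ (↭-sym Y↭) (der Δ)

ax∈ : at p ∈ X → at p ∈ Y → Derivable≤ n X Y
ax∈ {p = p} p∈X p∈Y =
  Derivable≤-from-∈ˡ p∈X λ Γ → Derivable≤-from-∈ʳ p∈Y λ Δ → ax p Γ Δ , z≤n

⊥L∈ : ⊥′ ∈ X → Derivable≤ n X Y
⊥L∈ {Y = Y} ⊥∈X = Derivable≤-from-∈ˡ ⊥∈X λ Γ → ⊥L Γ Y , z≤n

∧L≤ : Derivable≤ n (A ∷ B ∷ X) Y → Derivable≤ (suc n) (A ∧′ B ∷ X) Y
∧L≤ (d , h) = ∧L d , s≤s h

∨L≤ : Derivable≤ n (A ∷ X) Y → Derivable≤ n (B ∷ X) Y → Derivable≤ (suc n) (A ∨′ B ∷ X) Y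
∨L≤ (d , h) (e , k) = ∨L d e , s≤s (⊔-lub h k)

∧R≤ : Derivable≤ n X (A ∷ Y) → Derivable≤ n X (B ∷ Y) → Derivable≤ (suc n) X (A ∧′ B ∷ Y)
∧R≤ (d , h) (e , k) = ∧R d e , s≤s (⊔-lub h k)

∨R≤ : Derivable≤ n X (A ∷ B ∷ Y) → Derivable≤ (suc n) X (A ∨′ B ∷ Y)
∨R≤ (d , h) = ∨R d , s≤s h

data LeftPremise : Fm → List Fm → Set where
  ∧L-premise  : LeftPremise (A ∧′ B) (A ∷ B ∷ [])
  ∨L-premise₁ : LeftPremise (A ∨′ B) (A ∷ [])
  ∨L-premise₂ : LeftPremise (A ∨′ B) (B ∷ [])

data RightPremise : Fm → List Fm → Set where
  ∧R-premise₁ : RightPremise (A ∧′ B) (A ∷ [])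
  ∧R-premise₂ : RightPremise (A ∧′ B) (B ∷ [])
  ∨R-premise  : RightPremise (A ∨′ B) (A ∷ B ∷ [])

-- The formula being inverted (and, below, contracted) is kept at the end of the
-- context, so that the premises of non-principal rules, which extend the
-- context at the front, need no reshuffling.
invertL : LeftPremise F L → ∀ Γ n (d : Der X Δ) → height d ≤ n →
  X ↭ Γ ∷ʳ F → Derivable≤ n (Γ ++ L) Δ
invertL i Γ n (ax p _ _) h r with ∈-∷ʳ⁻ Γ (∷↭⇒∈ r)
... | inj₁ p∈Γ = ax∈ (∈-++⁺ˡ p∈Γ) (here refl)
... | inj₂ refl = case i of λ ()
invertL i Γ n (⊥L _ _) h r with ∈-∷ʳ⁻ Γ (∷↭⇒∈ r)
... | inj₁ ⊥∈Γ = ⊥L∈ (∈-++⁺ˡ ⊥∈Γ)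
... | inj₂ refl = case i of λ ()
invertL {L = L} i Γ (suc m) (∧L {A} {B} d) (s≤s h) r with ∷↭∷ʳ-inv Γ r
invertL ∧L-premise Γ (suc m) (∧L d) (s≤s h) r | inj₁ (refl , s) =
  Derivable≤-mono (n≤1+n m) (Derivable≤-respˡ-↭ (↭-++-comm _ s) (d , h))
... | inj₂ (Γ₀ , s , t) =
  Derivable≤-respˡ-↭ (++⁺ʳ L (↭-sym s))
    (∧L≤ (invertL i (A ∷ B ∷ Γ₀) m d h (prep A (prep B t))))
invertL {L = L} i Γ (suc m) (∨L {A} {B} d e) (s≤s h) r with ∷↭∷ʳ-inv Γ r
invertL ∨L-premise₁ Γ (suc m) (∨L d e) (s≤s h) r | inj₁ (refl , s) =
  Derivable≤-mono (n≤1+n m) (Derivable≤-respˡ-↭ (↭-++-comm _ s) (d , m⊔n≤o⇒m≤o _ _ h))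
invertL ∨L-premise₂ Γ (suc m) (∨L d e) (s≤s h) r | inj₁ (refl , s) =
  Derivable≤-mono (n≤1+n m) (Derivable≤-respˡ-↭ (↭-++-comm _ s) (e , m⊔n≤o⇒n≤o _ _ h))
... | inj₂ (Γ₀ , s , t) =
  Derivable≤-respˡ-↭ (++⁺ʳ L (↭-sym s))
    (∨L≤ (invertL i (A ∷ Γ₀) m d (m⊔n≤o⇒m≤o _ _ h) (prep A t))
         (invertL i (B ∷ Γ₀) m e (m⊔n≤o⇒n≤o _ _ h) (prep B t)))
invertL i Γ (suc m) (∧R d e) (s≤s h) r =
  ∧R≤ (invertL i Γ m d (m⊔n≤o⇒m≤o _ _ h) r) (invertL i Γ m e (m⊔n≤o⇒n≤o _ _ h) r)
invertL i Γ (suc m) (∨R d) (s≤s h) r = ∨R≤ (invertL i Γ m d h r)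
invertL {L = L} i Γ n (⇒R _ Y d) h r = ⇒R (Γ ++ L) Y d , h
invertL i Γ n (⇒LR _ Y d₁ d₂ d₃ d₄) h r with ∈-∷ʳ⁻ Γ (∷↭⇒∈ r)
... | inj₁ ⇒∈Γ = Derivable≤-from-∈ˡ (∈-++⁺ˡ ⇒∈Γ) λ Γ′ → ⇒LR Γ′ Y d₁ d₂ d₃ d₄ , h
... | inj₂ refl = case i of λ ()
invertL i Γ n (perm X↭ Y↭ d) h r = Derivable≤-respʳ-↭ Y↭ (invertL i Γ n d h (↭-trans X↭ r))

invertR : RightPremise F L → ∀ Δ n (d : Der Γ Y) → height d ≤ n →
  Y ↭ Δ ∷ʳ F → Derivable≤ n Γ (Δ ++ L)
invertR i Δ n (ax p _ _) h r with ∈-∷ʳ⁻ Δ (∷↭⇒∈ r)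
... | inj₁ p∈Δ = ax∈ (here refl) (∈-++⁺ˡ p∈Δ)
... | inj₂ refl = case i of λ ()
invertR {L = L} i Δ n (⊥L Γ _) h r = ⊥L Γ (Δ ++ L) , z≤n
invertR i Δ (suc m) (∧L d) (s≤s h) r = ∧L≤ (invertR i Δ m d h r)
invertR i Δ (suc m) (∨L d e) (s≤s h) r =
  ∨L≤ (invertR i Δ m d (m⊔n≤o⇒m≤o _ _ h) r) (invertR i Δ m e (m⊔n≤o⇒n≤o _ _ h) r)
invertR {L = L} i Δ (suc m) (∧R {A} {B} d e) (s≤s h) r with ∷↭∷ʳ-inv Δ r
invertR ∧R-premise₁ Δ (suc m) (∧R d e) (s≤s h) r | inj₁ (refl , s) =
  Derivable≤-mono (n≤1+n m) (Derivable≤-respʳ-↭ (↭-++-comm _ s) (d , m⊔n≤o⇒m≤o _ _ h))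
invertR ∧R-premise₂ Δ (suc m) (∧R d e) (s≤s h) r | inj₁ (refl , s) =
  Derivable≤-mono (n≤1+n m) (Derivable≤-respʳ-↭ (↭-++-comm _ s) (e , m⊔n≤o⇒n≤o _ _ h))
... | inj₂ (Δ₀ , s , t) =
  Derivable≤-respʳ-↭ (++⁺ʳ L (↭-sym s))
    (∧R≤ (invertR i (A ∷ Δ₀) m d (m⊔n≤o⇒m≤o _ _ h) (prep A t))
         (invertR i (B ∷ Δ₀) m e (m⊔n≤o⇒n≤o _ _ h) (prep B t)))
invertR {L = L} i Δ (suc m) (∨R {A} {B} d) (s≤s h) r with ∷↭∷ʳ-inv Δ r
invertR ∨R-premise Δ (suc m) (∨R d) (s≤s h) r | inj₁ (refl , s) =
  Derivable≤-mono (n≤1+n m) (Derivable≤-respʳ-↭ (↭-++-comm _ s) (d , h))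
... | inj₂ (Δ₀ , s , t) =
  Derivable≤-respʳ-↭ (++⁺ʳ L (↭-sym s))
    (∨R≤ (invertR i (A ∷ B ∷ Δ₀) m d h (prep A (prep B t))))
invertR i Δ n (⇒R Γ _ d) h r with ∈-∷ʳ⁻ Δ (∷↭⇒∈ r)
... | inj₁ ⇒∈Δ = Derivable≤-from-∈ʳ (∈-++⁺ˡ ⇒∈Δ) λ Δ′ → ⇒R Γ Δ′ d , h
... | inj₂ refl = case i of λ ()
invertR i Δ n (⇒LR Γ _ d₁ d₂ d₃ d₄) h r with ∈-∷ʳ⁻ Δ (∷↭⇒∈ r)
... | inj₁ ⇒∈Δ = Derivable≤-from-∈ʳ (∈-++⁺ˡ ⇒∈Δ) λ Δ′ → ⇒LR Γ Δ′ d₁ d₂ d₃ d₄ , h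
... | inj₂ refl = case i of λ ()
invertR i Δ n (perm X↭ Y↭ d) h r = Derivable≤-respˡ-↭ X↭ (invertR i Δ n d h (↭-trans Y↭ r))

mutual
  contractL : ∀ Γ n (d : Der X Δ) → height d ≤ n →
    X ↭ Γ ++ D ∷ D ∷ [] → Derivable≤ n (Γ ∷ʳ D) Δ
  contractL Γ n (ax p _ _) h r = ax∈ (dup-⊆ Γ (∷↭⇒∈ r)) (here refl)
  contractL Γ n (⊥L _ _) h r = ⊥L∈ (dup-⊆ Γ (∷↭⇒∈ r))
  contractL {Δ = Δ} {D = D} Γ (suc m) (∧L {A} {B} d) (s≤s h) r with ∷↭++∷∷-inv Γ r
  ... | inj₁ (refl , s) =
    Derivable≤-respˡ-↭ (∷↭∷ʳ _ Γ)
      (∧L≤ (Derivable≤-respˡ-↭ (prep A (↭-sym (∷↭∷ʳ B Γ))) B-contracted))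
    where
    inverted : Derivable≤ m (A ∷ B ∷ Γ ++ A ∷ B ∷ []) Δ
    inverted = invertL ∧L-premise (A ∷ B ∷ Γ) m d h (prep A (prep B s))
    A-contracted : Derivable≤ m (A ∷ B ∷ Γ ∷ʳ B) Δ
    A-contracted = contractL-∷ (Derivable≤-respˡ-↭ (prep A (shift A (B ∷ Γ) (B ∷ []))) inverted)
    B-contracted : Derivable≤ m (A ∷ Γ ∷ʳ B) Δ
    B-contracted = contractL≤ (A ∷ Γ) A-contracted (prep A (↭-sym (shift B Γ (B ∷ []))))
  ... | inj₂ (Γ₀ , s , t) =
    Derivable≤-respˡ-↭ (++⁺ʳ (D ∷ []) (↭-sym s))
      (∧L≤ (contractL (A ∷ B ∷ Γ₀) m d h (prep A (prep B t))))
  contractL {Δ = Δ} {D = D} Γ (suc m) (∨L {A} {B} d e) (s≤s h) r with ∷↭++∷∷-inv Γ r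
  ... | inj₁ (refl , s) =
    Derivable≤-respˡ-↭ (∷↭∷ʳ _ Γ) (∨L≤ (contractL-∷ A-inverted) (contractL-∷ B-inverted))
    where
    A-inverted : Derivable≤ m (A ∷ A ∷ Γ) Δ
    A-inverted = Derivable≤-respˡ-↭ (prep A (↭-sym (∷↭∷ʳ A Γ)))
      (invertL ∨L-premise₁ (A ∷ Γ) m d (m⊔n≤o⇒m≤o _ _ h) (prep A s))
    B-inverted : Derivable≤ m (B ∷ B ∷ Γ) Δ
    B-inverted = Derivable≤-respˡ-↭ (prep B (↭-sym (∷↭∷ʳ B Γ)))
      (invertL ∨L-premise₂ (B ∷ Γ) m e (m⊔n≤o⇒n≤o _ _ h) (prep B s))
  ... | inj₂ (Γ₀ , s , t) =
    Derivable≤-respˡ-↭ (++⁺ʳ (D ∷ []) (↭-sym s))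
      (∨L≤ (contractL (A ∷ Γ₀) m d (m⊔n≤o⇒m≤o _ _ h) (prep A t))
           (contractL (B ∷ Γ₀) m e (m⊔n≤o⇒n≤o _ _ h) (prep B t)))
  contractL Γ (suc m) (∧R d e) (s≤s h) r =
    ∧R≤ (contractL Γ m d (m⊔n≤o⇒m≤o _ _ h) r) (contractL Γ m e (m⊔n≤o⇒n≤o _ _ h) r)
  contractL Γ (suc m) (∨R d) (s≤s h) r = ∨R≤ (contractL Γ m d h r)
  contractL {D = D} Γ n (⇒R _ Y d) h r = ⇒R (Γ ∷ʳ D) Y d , h
  contractL Γ n (⇒LR _ Y d₁ d₂ d₃ d₄) h r =
    Derivable≤-from-∈ˡ (dup-⊆ Γ (∷↭⇒∈ r)) λ Γ′ → ⇒LR Γ′ Y d₁ d₂ d₃ d₄ , h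
  contractL Γ n (perm X↭ Y↭ d) h r = Derivable≤-respʳ-↭ Y↭ (contractL Γ n d h (↭-trans X↭ r))

  contractL≤ : ∀ Γ → Derivable≤ n X Δ → X ↭ Γ ++ D ∷ D ∷ [] → Derivable≤ n (Γ ∷ʳ D) Δ
  contractL≤ Γ (d , h) = contractL Γ _ d h

  contractL-∷ : Derivable≤ n (D ∷ D ∷ Γ) Δ → Derivable≤ n (D ∷ Γ) Δ
  contractL-∷ {D = D} {Γ = Γ} der =
    Derivable≤-respˡ-↭ (↭-sym (∷↭∷ʳ D Γ)) (contractL≤ Γ der (++-comm (D ∷ D ∷ []) Γ))

mutual
  contractR : ∀ Δ n (d : Der Γ Y) → height d ≤ n →
    Y ↭ Δ ++ D ∷ D ∷ [] → Derivable≤ n Γ (Δ ∷ʳ D)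
  contractR Δ n (ax p _ _) h r = ax∈ (here refl) (dup-⊆ Δ (∷↭⇒∈ r))
  contractR {D = D} Δ n (⊥L Γ _) h r = ⊥L Γ (Δ ∷ʳ D) , z≤n
  contractR Δ (suc m) (∧L d) (s≤s h) r = ∧L≤ (contractR Δ m d h r)
  contractR Δ (suc m) (∨L d e) (s≤s h) r =
    ∨L≤ (contractR Δ m d (m⊔n≤o⇒m≤o _ _ h) r) (contractR Δ m e (m⊔n≤o⇒n≤o _ _ h) r)
  contractR {Γ = Γ} {D = D} Δ (suc m) (∧R {A} {B} d e) (s≤s h) r with ∷↭++∷∷-inv Δ r
  ... | inj₁ (refl , s) =
    Derivable≤-respʳ-↭ (∷↭∷ʳ _ Δ) (∧R≤ (contractR-∷ A-inverted) (contractR-∷ B-inverted))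
    where
    A-inverted : Derivable≤ m Γ (A ∷ A ∷ Δ)
    A-inverted = Derivable≤-respʳ-↭ (prep A (↭-sym (∷↭∷ʳ A Δ)))
      (invertR ∧R-premise₁ (A ∷ Δ) m d (m⊔n≤o⇒m≤o _ _ h) (prep A s))
    B-inverted : Derivable≤ m Γ (B ∷ B ∷ Δ)
    B-inverted = Derivable≤-respʳ-↭ (prep B (↭-sym (∷↭∷ʳ B Δ)))
      (invertR ∧R-premise₂ (B ∷ Δ) m e (m⊔n≤o⇒n≤o _ _ h) (prep B s))
  ... | inj₂ (Δ₀ , s , t) =
    Derivable≤-respʳ-↭ (++⁺ʳ (D ∷ []) (↭-sym s))
      (∧R≤ (contractR (A ∷ Δ₀) m d (m⊔n≤o⇒m≤o _ _ h) (prep A t))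
           (contractR (B ∷ Δ₀) m e (m⊔n≤o⇒n≤o _ _ h) (prep B t)))
  contractR {Γ = Γ} {D = D} Δ (suc m) (∨R {A} {B} d) (s≤s h) r with ∷↭++∷∷-inv Δ r
  ... | inj₁ (refl , s) =
    Derivable≤-respʳ-↭ (∷↭∷ʳ _ Δ)
      (∨R≤ (Derivable≤-respʳ-↭ (prep A (↭-sym (∷↭∷ʳ B Δ))) B-contracted))
    where
    inverted : Derivable≤ m Γ (A ∷ B ∷ Δ ++ A ∷ B ∷ [])
    inverted = invertR ∨R-premise (A ∷ B ∷ Δ) m d h (prep A (prep B s))
    A-contracted : Derivable≤ m Γ (A ∷ B ∷ Δ ∷ʳ B)
    A-contracted = contractR-∷ (Derivable≤-respʳ-↭ (prep A (shift A (B ∷ Δ) (B ∷ []))) inverted)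
    B-contracted : Derivable≤ m Γ (A ∷ Δ ∷ʳ B)
    B-contracted = contractR≤ (A ∷ Δ) A-contracted (prep A (↭-sym (shift B Δ (B ∷ []))))
  ... | inj₂ (Δ₀ , s , t) =
    Derivable≤-respʳ-↭ (++⁺ʳ (D ∷ []) (↭-sym s))
      (∨R≤ (contractR (A ∷ B ∷ Δ₀) m d h (prep A (prep B t))))
  contractR Δ n (⇒R Γ _ d) h r =
    Derivable≤-from-∈ʳ (dup-⊆ Δ (∷↭⇒∈ r)) λ Δ′ → ⇒R Γ Δ′ d , h
  contractR Δ n (⇒LR Γ _ d₁ d₂ d₃ d₄) h r =
    Derivable≤-from-∈ʳ (dup-⊆ Δ (∷↭⇒∈ r)) λ Δ′ → ⇒LR Γ Δ′ d₁ d₂ d₃ d₄ , h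
  contractR Δ n (perm X↭ Y↭ d) h r = Derivable≤-respˡ-↭ X↭ (contractR Δ n d h (↭-trans Y↭ r))

  contractR≤ : ∀ Δ → Derivable≤ n Γ Y → Y ↭ Δ ++ D ∷ D ∷ [] → Derivable≤ n Γ (Δ ∷ʳ D)
  contractR≤ Δ (d , h) = contractR Δ _ d h

  contractR-∷ : Derivable≤ n Γ (D ∷ D ∷ Δ) → Derivable≤ n Γ (D ∷ Δ)
  contractR-∷ {D = D} {Δ = Δ} der =
    Derivable≤-respʳ-↭ (↭-sym (∷↭∷ʳ D Δ)) (contractR≤ Δ der (++-comm (D ∷ D ∷ []) Δ))

mainTheorem2 : ∀ (Γ Δ : List Fm) (D : Fm) (n : ℕ) →
    (Derivable≤ n (D ∷ D ∷ Γ) Δ → Derivable≤ n (D ∷ Γ) Δ) ×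
    (Derivable≤ n Γ (Δ ++ D ∷ D ∷ []) → Derivable≤ n Γ (Δ ++ D ∷ []))
mainTheorem2 Γ Δ D n = contractL-∷ , λ der → contractR≤ Δ der ↭-refl
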